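{- If $n\ge 8$ and $\varphi(\vec{x},\vec{y})$ is a generalized $P$-encoding on $n$ input variables in regular form, then $\varphi$ has at least $2n+\sqrt{n+1}-2$ clauses.
   Context: A CNF formula is a set of clauses (sets of literals). Let $\vec{x}=(x_1,\dots,x_n)$ be input variables and $\vec{y}$ a finite set of auxiliary variables. A CNF $\varphi(\vec{x},\vec{y})$ is a generalized $P$-encoding on $n$ input variables if (a) $\varphi\wedge x_i$ is satisfiable for each $i\in[n]$, and (b) $\varphi\models\overline{x_i}\vee\overline{x_j}$ for all distinct $i,j\in[n]$. Let $Q_{\varphi,i}$ be the set of clauses of $\varphi$ containing $\overline{x_i}$. $\varphi$ is in regular form if for each $i\in[n]$: $|Q_{\varphi,i}|=2$, $x_i$ is the only input variable occurring in the clauses of $Q_{\varphi,i}$, and each clause of $Q_{\varphi,i}$ has exactly two literals. -}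

module Defs where

open import Data.Nat using (ℕ; _+_; _*_; _∸_; _^_; _≤_)
open import Data.Fin using (Fin)
open import Data.Fin.Subset using (Subset; _∈_; _∉_; ∣_∣)
open import Data.Fin.Subset.Properties using (_∈?_)
open import Data.Bool using (Bool; true; false)
open import Data.List using (List; length; filter)
open import Data.List.Relation.Unary.All using (All)
open import Data.List.Relation.Unary.Unique.Propositional using (Unique)
open import Data.List.Membership.Propositional using () renaming (_∈_ to _∈ₗ_)
open import Data.Product using (Σ; ∃; _×_)
open import Data.Sum using (_⊎_)
open import Relation.Binary.PropositionalEquality using (_≡_; _≢_)
open import Relation.Nullary using (¬_)

-- A clause is a SET of literals, represented by four subsets:
-- the input variables occurring positively / negatively and the auxiliary
-- variables occurring positively / negatively.
record Clause (n m : ℕ) : Set where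
  constructor clause
  field
    posX : Subset n
    negX : Subset n
    posY : Subset m
    negY : Subset m
open Clause public

size : ∀ {n m} → Clause n m → ℕ
size C = ∣ posX C ∣ + ∣ negX C ∣ + ∣ posY C ∣ + ∣ negY C ∣

-- A CNF is a finite SET of clauses: a duplicate-free list.
record CNF (n m : ℕ) : Set where
  constructor cnf
  field
    clauses : List (Clause n m)
    unique  : Unique clauses
open CNF public

#clauses : ∀ {n m} → CNF n m → ℕ
#clauses φ = length (clauses φ)

record Assignment (n m : ℕ) : Set where
  constructor assign
  field
    ax : Fin n → Bool
    ay : Fin m → Bool
open Assignment public

SatClause : ∀ {n m} → Assignment n m → Clause n m → Set
SatClause α C =
  (∃ λ i → i ∈ posX C × ax α i ≡ true) ⊎
  (∃ λ i → i ∈ negX C × ax α i ≡ false) ⊎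
  (∃ λ k → k ∈ posY C × ay α k ≡ true) ⊎
  (∃ λ k → k ∈ negY C × ay α k ≡ false)

Sat : ∀ {n m} → Assignment n m → CNF n m → Set
Sat α φ = All (SatClause α) (clauses φ)

IsGenPEncoding : ∀ {n m} → CNF n m → Set
IsGenPEncoding {n} {m} φ =
  ((i : Fin n) → ∃ λ (α : Assignment n m) → Sat α φ × ax α i ≡ true) ×
  ((i j : Fin n) → i ≢ j → (α : Assignment n m) → Sat α φ →
     ¬ (ax α i ≡ true × ax α j ≡ true))

Q : ∀ {n m} → CNF n m → Fin n → List (Clause n m)
Q φ i = filter (λ C → i ∈? negX C) (clauses φ)

IsRegular : ∀ {n m} → CNF n m → Set
IsRegular {n} φ = (i : Fin n) →
  (length (Q φ i) ≡ 2) ×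
  (∀ C → C ∈ₗ Q φ i →
     (∀ j → j ≢ i → j ∉ posX C × j ∉ negX C) × size C ≡ 2)

{-# OPTIONS --safe #-}
module Submission where

-- Fix for each i a model of φ ∧ x_i; by (b) it makes every other x_l false. Call β_i its auxiliary
-- part, T_i the auxiliary literals λ with {¬x_i, λ} ∈ φ (at most two, all true under β_i), and Γ_i
-- the negations of the auxiliary literals through which β_i satisfies the clauses containing no ¬x_l
-- with l ≠ i. Each clause contains at most one negative input literal and there are 2n of them, so
-- |Γ_i| ≤ K := |φ| + 2 − 2n. If T_j missed Γ_i for some j ≠ i, overriding β_i by T_j and setting
-- x_i = x_j = true would satisfy φ, contradicting (b); hence n ≤ 1 + Σ_{λ ∈ Γ_i} deg λ, where deg λ
-- counts the j with λ ∈ T_j. A case analysis on T_i gives deg λ ≤ 2 or deg λ ≤ K − 1, and since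
-- n ≥ 8 this forces n + 1 ≤ K².

open import Defs
open import Level using (Level; 0ℓ)
open import Data.Nat using (ℕ; zero; suc; _+_; _*_; _∸_; _^_; _≤_; _⊔_; pred; z≤n; s≤s; _≤?_)
open import Data.Nat.Properties
  using (+-0-commutativeMonoid; +-commutativeSemigroup; module ≤-Reasoning; ≤-refl; ≤-reflexive; ≤-trans; ≤-pred;
         <⇒≱; +-comm; +-suc; +-identityʳ; *-comm; *-suc; *-identityʳ; +-mono-≤; +-monoˡ-≤; +-monoʳ-≤; *-monoˡ-≤;
         m≤m+n; m≤n+m; m≤n⇒m≤1+n; m+n≤o⇒m≤o∸n; m≤n⇒m≤n⊔o; m≤n⇒m≤o⊔n; pred-mono-≤)
open import Data.Nat.Tactic.RingSolver using (solve-∀)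
open import Algebra.Properties.CommutativeMonoid.Sum +-0-commutativeMonoid
  using (sum-syntax; ∑-distrib-+; sum-cong-≗; sum-replicate-zero)
open import Algebra.Properties.CommutativeSemigroup +-commutativeSemigroup using (interchange)
open import Data.Fin using (Fin; zero; suc; _≟_)
open import Data.Fin.Properties as Finₚ using (any?)
open import Data.Fin.Subset using (Subset; _∈_; _∉_; ∣_∣)
open import Data.Fin.Subset.Properties using (_∈?_; x∈⁅y⁆⇒x≡y; x∈p⇒∣p-x∣<∣p∣; x∈p∧x∉q⇒x∈p─q)
open import Data.Bool as Bool using (Bool; true; false; not; _∨_; if_then_else_)
open import Data.Bool.Properties using (not-¬; ¬-not; not-injective; not-involutive; ∨-zeroʳ)
open import Data.List using (List; []; _∷_; length; filter; _++_)
open import Data.List.Properties using (length-++)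
open import Data.List.Relation.Unary.All as All using (All; []; _∷_)
open import Data.List.Relation.Unary.All.Properties using (¬Any⇒All¬; ++⁺; ++⁻ˡ; ++⁻ʳ)
open import Data.List.Relation.Unary.Any as Any using (Any; here; there)
open import Data.List.Relation.Unary.Any.Properties using (++⁺ˡ; ++⁺ʳ)
open import Data.List.Membership.Propositional using (find; lose) renaming (_∈_ to _∈ₗ_)
open import Data.List.Membership.Propositional.Properties using (∈-filter⁺; ∈-filter⁻)
open import Data.Product using (∃; ∃-syntax; _×_; _,_; proj₁; proj₂)
open import Data.Product.Properties using (≡-dec)
open import Data.Sum using (_⊎_; inj₁; inj₂)
open import Function using (_∘_; _∘₂_; case_of_)
open import Relation.Nullary using (Dec; yes; no; does; ¬_; contradiction)
open import Relation.Nullary.Decidable using (_×-dec_; _⊎-dec_; ¬?; dec-true; dec-false; decidable-stable; from-no; map′)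
open import Relation.Unary using (Pred; Decidable; _∩_; ∁)
open import Relation.Unary.Properties using (U?; _∩?_; ∁?)
open import Relation.Binary.PropositionalEquality

private
  variable
    a b p q : Level
    A : Set a
    B : Set b
    n m : ℕ

indicator : {P : Set p} → Dec P → ℕ
indicator P? = if does P? then 1 else 0

count : {P : Pred (Fin n) p} → Decidable P → ℕ
count {n = n} P? = ∑[ j < n ] indicator (P? j)

∑ₗ : List A → (A → ℕ) → ℕ
∑ₗ []       f = 0
∑ₗ (x ∷ xs) f = f x + ∑ₗ xs f

∑-const : ∀ n c → ∑[ _ < n ] c ≡ n * c
∑-const zero    c = refl
∑-const (suc n) c = cong (c +_) (∑-const n c)

∑ₗ-const : ∀ (xs : List A) c → ∑ₗ xs (λ _ → c) ≡ length xs * c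
∑ₗ-const []       c = refl
∑ₗ-const (x ∷ xs) c = cong (c +_) (∑ₗ-const xs c)

∑ₗ-distrib-+ : ∀ (xs : List A) f g → ∑ₗ xs (λ x → f x + g x) ≡ ∑ₗ xs f + ∑ₗ xs g
∑ₗ-distrib-+ []       f g = refl
∑ₗ-distrib-+ (x ∷ xs) f g =
  trans (cong (f x + g x +_) (∑ₗ-distrib-+ xs f g)) (interchange (f x) (g x) _ _)

∑ₗ-mono-≤ : ∀ (xs : List A) {f g} → (∀ {x} → x ∈ₗ xs → f x ≤ g x) → ∑ₗ xs f ≤ ∑ₗ xs g
∑ₗ-mono-≤ []       f≤g = z≤n
∑ₗ-mono-≤ (x ∷ xs) f≤g = +-mono-≤ (f≤g (here refl)) (∑ₗ-mono-≤ xs (f≤g ∘ there))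

∑ₗ≤length : ∀ (xs : List A) {f} → (∀ {x} → x ∈ₗ xs → f x ≤ 1) → ∑ₗ xs f ≤ length xs
∑ₗ≤length xs f≤1 = ≤-trans (∑ₗ-mono-≤ xs f≤1) (≤-reflexive (trans (∑ₗ-const xs 1) (*-identityʳ _)))

1+∑ₗ≤length : ∀ (xs : List A) {f y} → (∀ {x} → x ∈ₗ xs → f x ≤ 1) →
  y ∈ₗ xs → f y ≡ 0 → 1 + ∑ₗ xs f ≤ length xs
1+∑ₗ≤length (x ∷ xs) f≤1 (here refl) fy≡0 rewrite fy≡0 = s≤s (∑ₗ≤length xs (f≤1 ∘ there))
1+∑ₗ≤length (x ∷ xs) {f} f≤1 (there y∈) fy≡0 =
  subst (_≤ suc (length xs)) (+-suc (f x) _)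
    (+-mono-≤ (f≤1 (here refl)) (1+∑ₗ≤length xs (f≤1 ∘ there) y∈ fy≡0))

2+∑ₗ≤length : ∀ (xs : List A) {f y z} → (∀ {x} → x ∈ₗ xs → f x ≤ 1) →
  y ∈ₗ xs → z ∈ₗ xs → y ≢ z → f y ≡ 0 → f z ≡ 0 → 2 + ∑ₗ xs f ≤ length xs
2+∑ₗ≤length (x ∷ xs) f≤1 (here refl) (here refl) y≢z _ _ = contradiction refl y≢z
2+∑ₗ≤length (x ∷ xs) f≤1 (here refl) (there z∈) _ fy≡0 fz≡0 rewrite fy≡0 =
  s≤s (1+∑ₗ≤length xs (f≤1 ∘ there) z∈ fz≡0)
2+∑ₗ≤length (x ∷ xs) f≤1 (there y∈) (here refl) _ fy≡0 fz≡0 rewrite fz≡0 =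
  s≤s (1+∑ₗ≤length xs (f≤1 ∘ there) y∈ fy≡0)
2+∑ₗ≤length (x ∷ xs) {f} f≤1 (there y∈) (there z∈) y≢z fy≡0 fz≡0 =
  subst (_≤ suc (length xs)) (trans (+-suc (f x) _) (cong suc (+-suc (f x) _)))
    (+-mono-≤ (f≤1 (here refl)) (2+∑ₗ≤length xs (f≤1 ∘ there) y∈ z∈ y≢z fy≡0 fz≡0))

length-filter≡∑ₗ-indicator : ∀ {P : Pred A p} (P? : Decidable P) xs →
  length (filter P? xs) ≡ ∑ₗ xs (indicator ∘ P?)
length-filter≡∑ₗ-indicator P? []       = refl
length-filter≡∑ₗ-indicator P? (x ∷ xs) with does (P? x)
... | true  = cong suc (length-filter≡∑ₗ-indicator P? xs)
... | false = length-filter≡∑ₗ-indicator P? xs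

∑-∑ₗ-comm : ∀ (xs : List A) (f : Fin n → A → ℕ) →
  ∑[ j < n ] ∑ₗ xs (f j) ≡ ∑ₗ xs (λ x → ∑[ j < n ] f j x)
∑-∑ₗ-comm {n = n} []       f = sum-replicate-zero n
∑-∑ₗ-comm         (x ∷ xs) f =
  trans (∑-distrib-+ (λ j → f j x) (λ j → ∑ₗ xs (f j))) (cong (_ +_) (∑-∑ₗ-comm xs f))

count≡0 : {P : Pred (Fin n) p} (P? : Decidable P) → (∀ j → ¬ P j) → count P? ≡ 0
count≡0 {n = zero}  P? ¬P = refl
count≡0 {n = suc n} P? ¬P with P? zero
... | yes p = contradiction p (¬P zero)
... | no _  = count≡0 (P? ∘ suc) (¬P ∘ suc)

count≤1 : {P : Pred (Fin n) p} (P? : Decidable P) → (∀ {i j} → P i → P j → i ≡ j) → count P? ≤ 1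
count≤1 {n = zero}  P? unique = z≤n
count≤1 {n = suc n} P? unique with P? zero
... | yes p = s≤s (≤-reflexive (count≡0 (P? ∘ suc) (λ j q → Finₚ.0≢1+n (unique p q))))
... | no _  = count≤1 (P? ∘ suc) (λ p q → Finₚ.suc-injective (unique p q))

count-split : {P : Pred (Fin n) p} {Q : Pred (Fin n) q} (P? : Decidable P) (Q? : Decidable Q) →
  count P? ≤ count Q? + count (P? ∩? ∁? Q?)
count-split {n = zero}  P? Q? = z≤n
count-split {n = suc n} P? Q? with P? zero | Q? zero
... | yes _ | yes _ = s≤s (count-split (P? ∘ suc) (Q? ∘ suc))
... | yes _ | no _  = subst (suc (count (P? ∘ suc)) ≤_) (sym (+-suc (count (Q? ∘ suc)) _))
                           (s≤s (count-split (P? ∘ suc) (Q? ∘ suc)))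
... | no _  | yes _ = m≤n⇒m≤1+n (count-split (P? ∘ suc) (Q? ∘ suc))
... | no _  | no _  = count-split (P? ∘ suc) (Q? ∘ suc)

count≤1+∑ₗ : {P : Pred (Fin n) p} {R : A → Pred (Fin n) q} (i : Fin n) (P? : Decidable P)
  (R? : ∀ x → Decidable (R x)) (xs : List A) →
  (∀ {j} → j ≢ i → P j → Any (λ x → R x j) xs) → count P? ≤ 1 + ∑ₗ xs (λ x → count (R? x))
count≤1+∑ₗ {P = P} i P? R? [] covered = count≤1 P? (λ p q → trans (only-i p) (sym (only-i q)))
  where
  only-i : ∀ {j} → P j → j ≡ i
  only-i {j} p = decidable-stable (j ≟ i) (λ j≢i → case covered j≢i p of λ ())
count≤1+∑ₗ {P = P} {R = R} i P? R? (x ∷ xs) covered = begin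
  count P?
    ≤⟨ count-split P? (R? x) ⟩
  count (R? x) + count (P? ∩? ∁? (R? x))
    ≤⟨ +-monoʳ-≤ (count (R? x)) (count≤1+∑ₗ i (P? ∩? ∁? (R? x)) R? xs covered′) ⟩
  count (R? x) + (1 + ∑ₗ xs (λ y → count (R? y)))
    ≡⟨ +-suc (count (R? x)) (∑ₗ xs (λ y → count (R? y))) ⟩
  1 + ∑ₗ (x ∷ xs) (λ y → count (R? y))
    ∎
  where
  open ≤-Reasoning
  covered′ : ∀ {j} → j ≢ i → (P ∩ ∁ (R x)) j → Any (λ y → R y j) xs
  covered′ j≢i (p , ¬r) with covered j≢i p
  ... | here r    = contradiction r ¬r
  ... | there r∈ = r∈

pigeonhole-2 : ∀ {xs : List A} {x y z} → length xs ≡ 2 → x ∈ₗ xs → y ∈ₗ xs → z ∈ₗ xs →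
  x ≡ y ⊎ x ≡ z ⊎ y ≡ z
pigeonhole-2 {xs = _ ∷ _ ∷ []} refl (here refl)         (here refl)         _                   = inj₁ refl
pigeonhole-2 {xs = _ ∷ _ ∷ []} refl (there (here refl)) (there (here refl)) _                   = inj₁ refl
pigeonhole-2 {xs = _ ∷ _ ∷ []} refl (here refl)         (there (here refl)) (here refl)         = inj₂ (inj₁ refl)
pigeonhole-2 {xs = _ ∷ _ ∷ []} refl (here refl)         (there (here refl)) (there (here refl)) = inj₂ (inj₂ refl)
pigeonhole-2 {xs = _ ∷ _ ∷ []} refl (there (here refl)) (here refl)         (here refl)         = inj₂ (inj₂ refl)
pigeonhole-2 {xs = _ ∷ _ ∷ []} refl (there (here refl)) (here refl)         (there (here refl)) = inj₂ (inj₁ refl)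

x∈p⇒1≤∣p∣ : ∀ {x : Fin n} {p : Subset n} → x ∈ p → 1 ≤ ∣ p ∣
x∈p⇒1≤∣p∣ x∈p = ≤-trans (s≤s z≤n) (x∈p⇒∣p-x∣<∣p∣ x∈p)

x,y∈p⇒2≤∣p∣ : ∀ {x y : Fin n} {p : Subset n} → x ∈ p → y ∈ p → x ≢ y → 2 ≤ ∣ p ∣
x,y∈p⇒2≤∣p∣ {x = x} x∈p y∈p x≢y =
  ≤-trans (s≤s (x∈p⇒1≤∣p∣ y∈p-x)) (x∈p⇒∣p-x∣<∣p∣ x∈p)
  where y∈p-x = x∈p∧x∉q⇒x∈p─q y∈p (x≢y ∘ sym ∘ x∈⁅y⁆⇒x≡y x)

-- (v , s) is the auxiliary literal y_v when s is true and ¬y_v when s is false.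
AuxLit : ℕ → Set
AuxLit m = Fin m × Bool

_≟ₗ_ : (ℓ ℓ′ : AuxLit m) → Dec (ℓ ≡ ℓ′)
_≟ₗ_ = ≡-dec _≟_ Bool._≟_

negate : AuxLit m → AuxLit m
negate (v , s) = v , not s

negate-injective : ∀ {ℓ ℓ′ : AuxLit m} → negate ℓ ≡ negate ℓ′ → ℓ ≡ ℓ′
negate-injective {ℓ = v , s} {w , t} eq = cong₂ _,_ (cong proj₁ eq) (not-injective (cong proj₂ eq))

Holds : (Fin m → Bool) → AuxLit m → Set
Holds β (v , s) = β v ≡ s

holds⇒¬negate-holds : ∀ (β : Fin m → Bool) ℓ → Holds β ℓ → ¬ Holds β (negate ℓ)
holds⇒¬negate-holds β (v , s) h h′ = not-¬ refl (trans (sym h) h′)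

¬negate-holds⇒holds : ∀ (β : Fin m → Bool) ℓ → ¬ Holds β (negate ℓ) → Holds β ℓ
¬negate-holds⇒holds β (v , s) ¬h = trans (¬-not ¬h) (not-involutive s)

∃AuxLit? : {P : Pred (AuxLit m) p} → Decidable P → Dec (∃ P)
∃AuxLit? P? = map′ (λ { (v , inj₁ p) → (v , true) , p ; (v , inj₂ p) → (v , false) , p })
                   (λ { ((v , true) , p) → v , inj₁ p ; ((v , false) , p) → v , inj₂ p })
                   (any? (λ v → P? (v , true) ⊎-dec P? (v , false)))

override : {S : Pred (AuxLit m) p} → Decidable S → (Fin m → Bool) → Fin m → Bool
override S? β v = if does (S? (v , true)) then true else if does (S? (v , false)) then false else β v

module _ {S : Pred (AuxLit m) p} (S? : Decidable S) (β : Fin m → Bool) where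

  override-sets : (∀ {ℓ} → S ℓ → ¬ S (negate ℓ)) → ∀ {ℓ} → S ℓ → Holds (override S? β) ℓ
  override-sets consistent {v , true} s with S? (v , true)
  ... | yes _ = refl
  ... | no ¬s = contradiction s ¬s
  override-sets consistent {v , false} s with S? (v , true) | S? (v , false)
  ... | yes s′ | _     = contradiction s′ (consistent s)
  ... | no _   | yes _ = refl
  ... | no _   | no ¬s = contradiction s ¬s

  override-keeps : ∀ {ℓ} → ¬ S (negate ℓ) → Holds β ℓ → Holds (override S? β) ℓ
  override-keeps {v , true} ¬s h with S? (v , true) | S? (v , false)
  ... | yes _ | _     = refl
  ... | no _  | yes s = contradiction s ¬s
  ... | no _  | no _  = h
  override-keeps {v , false} ¬s h with S? (v , true) | S? (v , false)
  ... | yes s | _     = contradiction s ¬s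
  ... | no _  | yes _ = refl
  ... | no _  | no _  = h

Occurs : AuxLit m → Clause n m → Set
Occurs (v , true)  C = v ∈ posY C
Occurs (v , false) C = v ∈ negY C

occurs? : (ℓ : AuxLit m) (C : Clause n m) → Dec (Occurs ℓ C)
occurs? (v , true)  C = v ∈? posY C
occurs? (v , false) C = v ∈? negY C

auxSize : Clause n m → ℕ
auxSize C = ∣ posY C ∣ + ∣ negY C ∣

occurs⇒1≤auxSize : ∀ {ℓ : AuxLit m} {C : Clause n m} → Occurs ℓ C → 1 ≤ auxSize C
occurs⇒1≤auxSize {ℓ = v , true}  {C} o = ≤-trans (x∈p⇒1≤∣p∣ o) (m≤m+n _ _)
occurs⇒1≤auxSize {ℓ = v , false} {C} o = ≤-trans (x∈p⇒1≤∣p∣ o) (m≤n+m _ _)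

occurs-unique : ∀ {ℓ ℓ′ : AuxLit m} {C : Clause n m} →
  auxSize C ≤ 1 → Occurs ℓ C → Occurs ℓ′ C → ℓ ≡ ℓ′
occurs-unique {ℓ = v , true}  {w , true}  size≤1 o o′ with v ≟ w
... | yes refl = refl
... | no v≢w   = contradiction (≤-trans (x,y∈p⇒2≤∣p∣ o o′ v≢w) (m≤m+n _ _)) (<⇒≱ (s≤s size≤1))
occurs-unique {ℓ = v , false} {w , false} size≤1 o o′ with v ≟ w
... | yes refl = refl
... | no v≢w   = contradiction (≤-trans (x,y∈p⇒2≤∣p∣ o o′ v≢w) (m≤n+m _ _)) (<⇒≱ (s≤s size≤1))
occurs-unique {ℓ = v , true}  {w , false} size≤1 o o′ =
  contradiction (+-mono-≤ (x∈p⇒1≤∣p∣ o) (x∈p⇒1≤∣p∣ o′)) (<⇒≱ (s≤s size≤1))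
occurs-unique {ℓ = v , false} {w , true}  size≤1 o o′ =
  contradiction (+-mono-≤ (x∈p⇒1≤∣p∣ o′) (x∈p⇒1≤∣p∣ o)) (<⇒≱ (s≤s size≤1))

negatedAuxWitness : ∀ {α : Assignment n m} {C : Clause n m} → SatClause α C → List (AuxLit m)
negatedAuxWitness (inj₁ _)                     = []
negatedAuxWitness (inj₂ (inj₁ _))              = []
negatedAuxWitness (inj₂ (inj₂ (inj₁ (v , _)))) = (v , false) ∷ []
negatedAuxWitness (inj₂ (inj₂ (inj₂ (v , _)))) = (v , true) ∷ []

negatedAuxWitness-false : ∀ {α : Assignment n m} {C : Clause n m} (s : SatClause α C) →
  All (¬_ ∘ Holds (ay α)) (negatedAuxWitness s)
negatedAuxWitness-false (inj₁ _)                         = []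
negatedAuxWitness-false (inj₂ (inj₁ _))                  = []
negatedAuxWitness-false {α = α} (inj₂ (inj₂ (inj₁ (v , _ , h)))) =
  holds⇒¬negate-holds (ay α) (v , true) h ∷ []
negatedAuxWitness-false {α = α} (inj₂ (inj₂ (inj₂ (v , _ , h)))) =
  holds⇒¬negate-holds (ay α) (v , false) h ∷ []

negatedAuxWitness-length : ∀ {α : Assignment n m} {C : Clause n m} (s : SatClause α C) →
  length (negatedAuxWitness s) ≤ 1
negatedAuxWitness-length (inj₁ _)               = z≤n
negatedAuxWitness-length (inj₂ (inj₁ _))        = z≤n
negatedAuxWitness-length (inj₂ (inj₂ (inj₁ _))) = ≤-refl
negatedAuxWitness-length (inj₂ (inj₂ (inj₂ _))) = ≤-refl

module _ {P : Pred A p} (f : ∀ {x} → P x → List B) where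

  collect : ∀ {xs} → All P xs → List B
  collect []         = []
  collect (px ∷ pxs) = f px ++ collect pxs

  length-collect : ∀ {xs} {g : A → ℕ} (pxs : All P xs) → (∀ {x} (px : P x) → length (f px) ≤ g x) →
    length (collect pxs) ≤ ∑ₗ xs g
  length-collect []         bound = z≤n
  length-collect (px ∷ pxs) bound =
    subst (_≤ _) (sym (length-++ (f px))) (+-mono-≤ (bound px) (length-collect pxs bound))

  collect-All⁺ : ∀ {xs} {Q : Pred B q} (pxs : All P xs) → (∀ {x} (px : P x) → All Q (f px)) →
    All Q (collect pxs)
  collect-All⁺ []         all = []
  collect-All⁺ (px ∷ pxs) all = ++⁺ (all px) (collect-All⁺ pxs all)

  collect-All⁻ : ∀ {xs x} {Q : Pred B q} (pxs : All P xs) → All Q (collect pxs) →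
    (x∈ : x ∈ₗ xs) → All Q (f (All.lookup pxs x∈))
  collect-All⁻ (px ∷ pxs) all (here refl) = ++⁻ˡ (f px) all
  collect-All⁻ (px ∷ pxs) all (there x∈) = collect-All⁻ pxs (++⁻ʳ (f px) all) x∈

  collect-∈ : ∀ {xs x y} (pxs : All P xs) (x∈ : x ∈ₗ xs) → y ∈ₗ f (All.lookup pxs x∈) → y ∈ₗ collect pxs
  collect-∈ (px ∷ pxs) (here refl) y∈ = ++⁺ˡ y∈
  collect-∈ (px ∷ pxs) (there x∈) y∈ = ++⁺ʳ (f px) (collect-∈ pxs x∈ y∈)

n+1≤K² : ∀ {n} K → 8 ≤ n → n ≤ 1 + K * (2 ⊔ pred K) → n + 1 ≤ K ^ 2
n+1≤K² 0 8≤n n≤ = contradiction (≤-trans 8≤n n≤) (from-no (8 ≤? 1))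
n+1≤K² 1 8≤n n≤ = contradiction (≤-trans 8≤n n≤) (from-no (8 ≤? 3))
n+1≤K² 2 8≤n n≤ = contradiction (≤-trans 8≤n n≤) (from-no (8 ≤? 5))
n+1≤K² {n} K@(suc K-1@(suc (suc t))) _ n≤ = begin
  n + 1         ≡⟨ +-comm n 1 ⟩
  suc n         ≤⟨ s≤s n≤ ⟩
  2 + K * K-1   ≤⟨ +-monoˡ-≤ (K * K-1) (s≤s (s≤s (z≤n {suc t}))) ⟩
  K + K * K-1   ≡⟨ *-suc K K-1 ⟨
  K * K         ≡⟨ cong (K *_) (*-identityʳ K) ⟨
  K ^ 2         ∎
  where open ≤-Reasoning

module RegularEncoding {n m} (φ : CNF n m) (enc : IsGenPEncoding φ) (reg : IsRegular φ) where

  private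
    variable
      i j k l : Fin n
      C : Clause n m
      ℓ c μ : AuxLit m

  ∈Q⇒ : C ∈ₗ Q φ j → C ∈ₗ clauses φ × j ∈ negX C
  ∈Q⇒ {j = j} = ∈-filter⁻ (λ C → j ∈? negX C)

  ∈Q⇐ : C ∈ₗ clauses φ → j ∈ negX C → C ∈ₗ Q φ j
  ∈Q⇐ {j = j} = ∈-filter⁺ (λ C → j ∈? negX C)

  Q-negX : C ∈ₗ Q φ j → l ∈ negX C → l ≡ j
  Q-negX {C = C} {j = j} {l = l} q l∈ =
    decidable-stable (l ≟ j) (λ l≢j → proj₂ (proj₁ (proj₂ (reg j) C q) l l≢j) l∈)

  Q-posX+auxSize≤1 : C ∈ₗ Q φ j → ∣ posX C ∣ + auxSize C ≤ 1
  Q-posX+auxSize≤1 {C = C} {j = j} q = ≤-pred (begin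
    suc (∣ posX C ∣ + auxSize C)
      ≤⟨ +-monoˡ-≤ (∣ posX C ∣ + auxSize C) (x∈p⇒1≤∣p∣ (proj₂ (∈Q⇒ q))) ⟩
    ∣ negX C ∣ + (∣ posX C ∣ + auxSize C)
      ≡⟨ regroup (∣ posX C ∣) (∣ negX C ∣) (∣ posY C ∣) (∣ negY C ∣) ⟩
    size C
      ≡⟨ proj₂ (proj₂ (reg j) C q) ⟩
    2
      ∎)
    where
    open ≤-Reasoning
    regroup : ∀ a b c d → b + (a + (c + d)) ≡ a + b + c + d
    regroup = solve-∀

  Q-occurs-unique : C ∈ₗ Q φ j → Occurs ℓ C → Occurs c C → ℓ ≡ c
  Q-occurs-unique {C = C} q = occurs-unique (≤-trans (m≤n+m (auxSize C) ∣ posX C ∣) (Q-posX+auxSize≤1 q))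

  Q-occurs⇒l∉posX : C ∈ₗ Q φ j → Occurs ℓ C → l ∉ posX C
  Q-occurs⇒l∉posX q o l∈ =
    contradiction (+-mono-≤ (x∈p⇒1≤∣p∣ l∈) (occurs⇒1≤auxSize o)) (<⇒≱ (s≤s (Q-posX+auxSize≤1 q)))

  model : Fin n → Assignment n m
  model i = proj₁ (proj₁ enc i)

  β : Fin n → Fin m → Bool
  β i = ay (model i)

  model-⊨ : ∀ i → Sat (model i) φ
  model-⊨ i = proj₁ (proj₂ (proj₁ enc i))

  model-sat : C ∈ₗ clauses φ → SatClause (model i) C
  model-sat {i = i} = All.lookup (model-⊨ i)

  model-xᵢ : ∀ i → ax (model i) i ≡ true
  model-xᵢ i = proj₂ (proj₂ (proj₁ enc i))

  model-xᵢ≢false : l ≡ i → ax (model i) l ≢ false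
  model-xᵢ≢false {i = i} refl ¬xᵢ with () ← trans (sym (model-xᵢ i)) ¬xᵢ

  model-off : l ≢ i → ax (model i) l ≡ false
  model-off {l = l} {i = i} l≢i =
    ¬-not (λ xₗ → proj₂ enc i l (≢-sym l≢i) (model i) (model-⊨ i) (model-xᵢ i , xₗ))

  model-on : ax (model i) l ≡ true → l ≡ i
  model-on {i = i} {l = l} xₗ = decidable-stable (l ≟ i) (λ l≢i → case trans (sym xₗ) (model-off l≢i) of λ ())

  Q-negatedAuxWitness : C ∈ₗ Q φ j → Occurs ℓ C → (s : SatClause (model j) C) →
    negate ℓ ∈ₗ negatedAuxWitness s
  Q-negatedAuxWitness q o (inj₁ (l , l∈ , _))               = contradiction l∈ (Q-occurs⇒l∉posX q o)
  Q-negatedAuxWitness q o (inj₂ (inj₁ (l , l∈ , ¬xₗ)))      = contradiction ¬xₗ (model-xᵢ≢false (Q-negX q l∈))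
  Q-negatedAuxWitness q o (inj₂ (inj₂ (inj₁ (v , o′ , _)))) = here (cong negate (Q-occurs-unique q o o′))
  Q-negatedAuxWitness q o (inj₂ (inj₂ (inj₂ (v , o′ , _)))) = here (cong negate (Q-occurs-unique q o o′))

  -- T j ℓ says that the two-literal clause {¬x_j, ℓ} belongs to φ.
  T : Fin n → AuxLit m → Set
  T j ℓ = Any (Occurs ℓ) (Q φ j)

  T? : ∀ j → Decidable (T j)
  T? j ℓ = Any.any? (occurs? ℓ) (Q φ j)

  T-holds : T j ℓ → Holds (β j) ℓ
  T-holds {j = j} {ℓ = ℓ} t with C , q , o ← find t =
    let s = model-sat (proj₁ (∈Q⇒ q)) in
    ¬negate-holds⇒holds (β j) ℓ (All.lookup (negatedAuxWitness-false s) (Q-negatedAuxWitness q o s))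

  T-consistent : T j ℓ → ¬ T j (negate ℓ)
  T-consistent {j = j} {ℓ = ℓ} t t′ = holds⇒¬negate-holds (β j) ℓ (T-holds t) (T-holds t′)

  T-atMostTwo : T j ℓ → T j c → T j μ → ℓ ≢ c → μ ≡ ℓ ⊎ μ ≡ c
  T-atMostTwo {j = j} tℓ tc tμ ℓ≢c with find tℓ | find tc | find tμ
  ... | _ , qℓ , oℓ | _ , qc , oc | _ , qμ , oμ with pigeonhole-2 (proj₁ (reg j)) qℓ qc qμ
  ...   | inj₁ refl        = contradiction (Q-occurs-unique qℓ oℓ oc) ℓ≢c
  ...   | inj₂ (inj₁ refl) = inj₁ (Q-occurs-unique qμ oμ oℓ)
  ...   | inj₂ (inj₂ refl) = inj₂ (Q-occurs-unique qμ oμ oc)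

  -- Every model of x_i satisfies an irrelevant clause through its literal ¬x_l.
  Irrelevant : Fin n → Clause n m → Set
  Irrelevant i C = ∃[ l ] l ∈ negX C × l ≢ i

  irrelevant? : ∀ i C → Dec (Irrelevant i C)
  irrelevant? i C = any? (λ l → l ∈? negX C ×-dec ¬? (l ≟ i))

  relevant⇒negX⊆⁅i⁆ : ¬ Irrelevant i C → l ∈ negX C → l ≡ i
  relevant⇒negX⊆⁅i⁆ {i = i} {l = l} ¬irr l∈ = decidable-stable (l ≟ i) (λ l≢i → ¬irr (l , l∈ , l≢i))

  Γ-part : ∀ i {C} → SatClause (model i) C → List (AuxLit m)
  Γ-part i {C} s = if does (irrelevant? i C) then [] else negatedAuxWitness s

  Γ : Fin n → List (AuxLit m)
  Γ i = collect (Γ-part i) (model-⊨ i)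

  Γ-false : ∀ i → All (¬_ ∘ Holds (β i)) (Γ i)
  Γ-false i = collect-All⁺ (Γ-part i) (model-⊨ i) part-false
    where
    part-false : (s : SatClause (model i) C) → All (¬_ ∘ Holds (β i)) (Γ-part i s)
    part-false {C = C} s with irrelevant? i C
    ... | yes _ = []
    ... | no _  = negatedAuxWitness-false s

  Γ-∋ : T i ℓ → negate ℓ ∈ₗ Γ i
  Γ-∋ {i = i} {ℓ = ℓ} t with C , q , o ← find t =
    collect-∈ (Γ-part i) (model-⊨ i) (proj₁ (∈Q⇒ q)) (part-∋ (model-sat (proj₁ (∈Q⇒ q))))
    where
    part-∋ : (s : SatClause (model i) C) → negate ℓ ∈ₗ Γ-part i s
    part-∋ s with irrelevant? i C
    ... | yes (l , l∈ , l≢i) = contradiction (Q-negX q l∈) l≢i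
    ... | no _               = Q-negatedAuxWitness q o s

  module _ (i j : Fin n) where

    both : Fin n → Bool
    both l = does (l ≟ i) ∨ does (l ≟ j)

    merged : Assignment n m
    merged = assign both (override (T? j) (β i))

    both-i : both i ≡ true
    both-i = cong (_∨ does (i ≟ j)) (dec-true (i ≟ i) refl)

    both-j : both j ≡ true
    both-j = trans (cong (does (j ≟ i) ∨_) (dec-true (j ≟ j) refl)) (∨-zeroʳ _)

    both-off : l ≢ i → l ≢ j → both l ≡ false
    both-off {l = l} l≢i l≢j = cong₂ _∨_ (dec-false (l ≟ i) l≢i) (dec-false (l ≟ j) l≢j)

    merged-sat-Q : C ∈ₗ Q φ j → SatClause (model j) C → SatClause merged C
    merged-sat-Q {C = C} q (inj₁ (l , l∈ , xₗ)) = inj₁ (j , subst (_∈ posX C) (model-on xₗ) l∈ , both-j)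
    merged-sat-Q q (inj₂ (inj₁ (l , l∈ , ¬xₗ))) = contradiction ¬xₗ (model-xᵢ≢false (Q-negX q l∈))
    merged-sat-Q q (inj₂ (inj₂ (inj₁ (v , o , _)))) =
      inj₂ (inj₂ (inj₁ (v , o , override-sets (T? j) (β i) T-consistent (lose q o))))
    merged-sat-Q q (inj₂ (inj₂ (inj₂ (v , o , _)))) =
      inj₂ (inj₂ (inj₂ (v , o , override-sets (T? j) (β i) T-consistent (lose q o))))

    merged-sat-relevant : ¬ Irrelevant i C → (s : SatClause (model i) C) →
      All (¬_ ∘ T j) (negatedAuxWitness s) → SatClause merged C
    merged-sat-relevant {C = C} _ (inj₁ (l , l∈ , xₗ)) _ =
      inj₁ (i , subst (_∈ posX C) (model-on xₗ) l∈ , both-i)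
    merged-sat-relevant {C = C} ¬irr (inj₂ (inj₁ (l , l∈ , ¬xₗ))) _ =
      contradiction ¬xₗ (model-xᵢ≢false (relevant⇒negX⊆⁅i⁆ {i = i} {C = C} ¬irr l∈))
    merged-sat-relevant _ (inj₂ (inj₂ (inj₁ (v , o , yᵥ)))) (¬t ∷ []) =
      inj₂ (inj₂ (inj₁ (v , o , override-keeps (T? j) (β i) ¬t yᵥ)))
    merged-sat-relevant _ (inj₂ (inj₂ (inj₂ (v , o , ¬yᵥ)))) (¬t ∷ []) =
      inj₂ (inj₂ (inj₂ (v , o , override-keeps (T? j) (β i) ¬t ¬yᵥ)))

    merged-sat : (C∈ : C ∈ₗ clauses φ) → All (¬_ ∘ T j) (Γ-part i (model-sat C∈)) → SatClause merged C
    merged-sat {C = C} C∈ ¬ts with irrelevant? i C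
    ... | no ¬irr = merged-sat-relevant ¬irr (model-sat C∈) ¬ts
    ... | yes (l , l∈ , l≢i) with l ≟ j
    ...   | yes refl = merged-sat-Q (∈Q⇐ C∈ l∈) (model-sat C∈)
    ...   | no l≢j   = inj₂ (inj₁ (l , l∈ , both-off l≢i l≢j))

  -- Otherwise merged i j would satisfy φ together with x_i and x_j.
  Γ-meets-T : i ≢ j → Any (T j) (Γ i)
  Γ-meets-T {i = i} {j = j} i≢j = decidable-stable (Any.any? (T? j) (Γ i)) λ ¬meets →
    proj₂ enc i j i≢j (merged i j)
      (All.tabulate λ C∈ →
        merged-sat i j C∈ (collect-All⁻ (Γ-part i) (model-⊨ i) (¬Any⇒All¬ _ ¬meets) C∈))
      (both-i i j , both-j i j)

  T-falsified : i ≢ j → ∃[ μ ] T j μ × ¬ Holds (β i) μ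
  T-falsified {i = i} i≢j with μ , μ∈ , t ← find (Γ-meets-T i≢j) = μ , t , All.lookup (Γ-false i) μ∈

  T-partner-false : T k ℓ → T k c → ℓ ≢ c → j ≢ k → T j ℓ → ¬ Holds (β j) c
  T-partner-false tℓ tc ℓ≢c j≢k tℓʲ with T-falsified j≢k
  ... | μ , tμ , ¬hμ with T-atMostTwo tℓ tc tμ ℓ≢c
  ...   | inj₁ refl = contradiction (T-holds tℓʲ) ¬hμ
  ...   | inj₂ refl = ¬hμ

  relevance : Fin n → Clause n m → ℕ
  relevance i C = indicator (¬? (irrelevant? i C))

  Γ-length : ∀ i → length (Γ i) ≤ ∑ₗ (clauses φ) (relevance i)
  Γ-length i = length-collect (Γ-part i) (model-⊨ i) part-length
    where
    part-length : (s : SatClause (model i) C) → length (Γ-part i s) ≤ relevance i C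
    part-length {C = C} s with irrelevant? i C
    ... | yes _ = z≤n
    ... | no _  = negatedAuxWitness-length s

  negCount : Clause n m → ℕ
  negCount C = count (_∈? negX C)

  negCount≤1 : C ∈ₗ clauses φ → negCount C ≤ 1
  negCount≤1 {C = C} C∈ = count≤1 (_∈? negX C) (λ k∈ l∈ → sym (Q-negX (∈Q⇐ C∈ k∈) l∈))

  relevance+negCount≤ : C ∈ₗ clauses φ → relevance i C + negCount C ≤ 1 + indicator (i ∈? negX C)
  relevance+negCount≤ {C = C} {i = i} C∈ with irrelevant? i C
  ... | yes _ = ≤-trans (negCount≤1 C∈) (m≤m+n 1 _)
  ... | no ¬irr with i ∈? negX C
  ...   | yes _ = s≤s (negCount≤1 C∈)
  ...   | no i∉ = s≤s (≤-reflexive (count≡0 (_∈? negX C) λ l l∈ →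
                    i∉ (subst (_∈ negX C) (relevant⇒negX⊆⁅i⁆ {i = i} {C = C} ¬irr l∈) l∈)))

  ∑negCount≡2n : ∑ₗ (clauses φ) negCount ≡ 2 * n
  ∑negCount≡2n = begin
    ∑ₗ (clauses φ) negCount
      ≡⟨ ∑-∑ₗ-comm (clauses φ) (λ l C → indicator (l ∈? negX C)) ⟨
    ∑[ l < n ] ∑ₗ (clauses φ) (λ C → indicator (l ∈? negX C))
      ≡⟨ sum-cong-≗ (λ l → length-filter≡∑ₗ-indicator (λ C → l ∈? negX C) (clauses φ)) ⟨
    ∑[ l < n ] length (Q φ l)  ≡⟨ sum-cong-≗ (λ l → proj₁ (reg l)) ⟩
    ∑[ l < n ] 2               ≡⟨ ∑-const n 2 ⟩
    n * 2                      ≡⟨ *-comm n 2 ⟩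
    2 * n                      ∎
    where open ≡-Reasoning

  2n≤#clauses : 2 * n ≤ #clauses φ
  2n≤#clauses = begin
    2 * n                    ≡⟨ ∑negCount≡2n ⟨
    ∑ₗ (clauses φ) negCount  ≤⟨ ∑ₗ≤length (clauses φ) negCount≤1 ⟩
    #clauses φ               ∎
    where open ≤-Reasoning

  ∑relevance+2n≤ : ∀ i → ∑ₗ (clauses φ) (relevance i) + 2 * n ≤ #clauses φ + 2
  ∑relevance+2n≤ i = begin
    ∑ₗ (clauses φ) (relevance i) + 2 * n
      ≡⟨ cong (∑ₗ (clauses φ) (relevance i) +_) ∑negCount≡2n ⟨
    ∑ₗ (clauses φ) (relevance i) + ∑ₗ (clauses φ) negCount
      ≡⟨ ∑ₗ-distrib-+ (clauses φ) (relevance i) negCount ⟨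
    ∑ₗ (clauses φ) (λ C → relevance i C + negCount C)
      ≤⟨ ∑ₗ-mono-≤ (clauses φ) relevance+negCount≤ ⟩
    ∑ₗ (clauses φ) (λ C → 1 + indicator (i ∈? negX C))
      ≡⟨ ∑ₗ-distrib-+ (clauses φ) (λ _ → 1) (λ C → indicator (i ∈? negX C)) ⟩
    ∑ₗ (clauses φ) (λ _ → 1) + ∑ₗ (clauses φ) (λ C → indicator (i ∈? negX C))
      ≡⟨ cong₂ _+_ (sym (trans (∑ₗ-const (clauses φ) 1) (*-identityʳ _)))
                   (length-filter≡∑ₗ-indicator (λ C → i ∈? negX C) (clauses φ)) ⟨
    #clauses φ + length (Q φ i)
      ≡⟨ cong (#clauses φ +_) (proj₁ (reg i)) ⟩
    #clauses φ + 2
      ∎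
    where open ≤-Reasoning

  slack : ℕ
  slack = #clauses φ + 2 ∸ 2 * n

  Γ-length≤slack : ∀ i → length (Γ i) ≤ slack
  Γ-length≤slack i = ≤-trans (Γ-length i) (m+n≤o⇒m≤o∸n _ (∑relevance+2n≤ i))

  degree : AuxLit m → ℕ
  degree ℓ = count (λ j → T? j ℓ)

  n≤1+∑degree : ∀ i → n ≤ 1 + ∑ₗ (Γ i) degree
  n≤1+∑degree i = subst (_≤ 1 + ∑ₗ (Γ i) degree) (trans (∑-const n 1) (*-identityʳ n))
    (count≤1+∑ₗ i U? (λ μ j → T? j μ) (Γ i) (λ j≢i _ → Γ-meets-T (≢-sym j≢i)))

  degree≤1 : (∀ {c} → T i c → c ≡ ℓ) → degree ℓ ≤ 1
  degree≤1 {i = i} {ℓ = ℓ} T-i⊆⁅ℓ⁆ = count≤1 (λ j → T? j ℓ) (λ t t′ → trans (only-i t) (sym (only-i t′)))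
    where
    only-i : T j ℓ → j ≡ i
    only-i {j = j} t = decidable-stable (j ≟ i) λ j≢i → case T-falsified j≢i of λ where
      (μ , tμ , ¬hμ) → ¬hμ (subst (Holds (β j)) (sym (T-i⊆⁅ℓ⁆ tμ)) (T-holds t))

  -- A j ∉ {i, k} with ℓ ∈ T j would have to falsify both c and ¬c under β j.
  degree≤2 : T i ℓ → T i c → ℓ ≢ c → T k ℓ → T k (negate c) → degree ℓ ≤ 2
  degree≤2 {i = i} {ℓ = ℓ} {c = c} {k = k} tℓ tc ℓ≢c tℓᵏ t¬cᵏ = begin
    degree ℓ                ≤⟨ count≤1+∑ₗ i (λ j → T? j ℓ) (λ k′ j → j ≟ k′) (k ∷ []) (here ∘₂ only-k) ⟩
    1 + (count (_≟ k) + 0)  ≡⟨ cong suc (+-identityʳ _) ⟩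
    1 + count (_≟ k)        ≤⟨ s≤s (count≤1 (_≟ k) (λ p q → trans p (sym q))) ⟩
    2                       ∎
    where
    open ≤-Reasoning
    ℓ≢¬c : ℓ ≢ negate c
    ℓ≢¬c ℓ≡¬c = holds⇒¬negate-holds (β i) c (T-holds tc) (subst (Holds (β i)) ℓ≡¬c (T-holds tℓ))
    only-k : j ≢ i → T j ℓ → j ≡ k
    only-k {j = j} j≢i tℓʲ = decidable-stable (j ≟ k) λ j≢k →
      T-partner-false tℓ tc ℓ≢c j≢i tℓʲ
        (¬negate-holds⇒holds (β j) c (T-partner-false tℓᵏ t¬cᵏ ℓ≢¬c j≢k tℓʲ))

  -- Each j ≠ i with ℓ ∈ T j pairs ℓ with some μ ∈ Γ i; every μ is paired so at most once, ¬ℓ and ¬c never.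
  degree<slack : T i ℓ → T i c → ℓ ≢ c → (∀ {j} → T j ℓ → ¬ T j (negate c)) → 1 + degree ℓ ≤ slack
  degree<slack {i = i} {ℓ = ℓ} {c = c} tℓ tc ℓ≢c ¬both = begin
    1 + degree ℓ                          ≤⟨ s≤s (count≤1+∑ₗ i (λ j → T? j ℓ) H? (Γ i) covered) ⟩
    2 + ∑ₗ (Γ i) (λ μ → count (H? μ))
      ≤⟨ 2+∑ₗ≤length (Γ i) H≤1 (Γ-∋ tℓ) (Γ-∋ tc) (ℓ≢c ∘ negate-injective) H¬ℓ≡0 H¬c≡0 ⟩
    length (Γ i)                          ≤⟨ Γ-length≤slack i ⟩
    slack                                 ∎
    where
    open ≤-Reasoning
    H : AuxLit m → Pred (Fin n) 0ℓ
    H μ j = T j ℓ × T j μ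
    H? : ∀ μ → Decidable (H μ)
    H? μ j = T? j ℓ ×-dec T? j μ
    covered : j ≢ i → T j ℓ → Any (λ μ → H μ j) (Γ i)
    covered j≢i tℓʲ = Any.map (tℓʲ ,_) (Γ-meets-T (≢-sym j≢i))
    H≤1 : μ ∈ₗ Γ i → count (H? μ) ≤ 1
    H≤1 {μ = μ} μ∈ = count≤1 (H? μ) λ {a} {b} (tℓᵃ , tμᵃ) (tℓᵇ , tμᵇ) →
      decidable-stable (a ≟ b) λ a≢b → T-partner-false tℓᵃ tμᵃ ℓ≢μ (≢-sym a≢b) tℓᵇ (T-holds tμᵇ)
      where
      ℓ≢μ : ℓ ≢ μ
      ℓ≢μ refl = All.lookup (Γ-false i) μ∈ (T-holds tℓ)
    H¬ℓ≡0 : count (H? (negate ℓ)) ≡ 0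
    H¬ℓ≡0 = count≡0 (H? (negate ℓ)) λ _ (tℓʲ , t¬ℓʲ) → T-consistent tℓʲ t¬ℓʲ
    H¬c≡0 : count (H? (negate c)) ≡ 0
    H¬c≡0 = count≡0 (H? (negate c)) λ _ (tℓʲ , t¬cʲ) → ¬both tℓʲ t¬cʲ

  degree≤2⊔pred-slack : ∀ ℓ → degree ℓ ≤ 2 ⊔ pred slack
  degree≤2⊔pred-slack ℓ with any? (λ i → T? i ℓ)
  ... | no ∄i = subst (_≤ _) (sym (count≡0 (λ j → T? j ℓ) λ j t → ∄i (j , t))) z≤n
  ... | yes (i , tℓ) with ∃AuxLit? (λ c → T? i c ×-dec ¬? (c ≟ₗ ℓ))
  ...   | no ∄c = m≤n⇒m≤n⊔o (pred slack) (≤-trans (degree≤1 T-i⊆⁅ℓ⁆) (s≤s z≤n))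
    where
    T-i⊆⁅ℓ⁆ : T i c → c ≡ ℓ
    T-i⊆⁅ℓ⁆ {c = c} t = decidable-stable (c ≟ₗ ℓ) λ c≢ℓ → ∄c (c , t , c≢ℓ)
  ...   | yes (c , tc , c≢ℓ) with any? (λ k → T? k ℓ ×-dec T? k (negate c))
  ...     | yes (k , tℓᵏ , t¬cᵏ) = m≤n⇒m≤n⊔o (pred slack) (degree≤2 tℓ tc (≢-sym c≢ℓ) tℓᵏ t¬cᵏ)
  ...     | no ∄k = m≤n⇒m≤o⊔n 2 (pred-mono-≤ (degree<slack tℓ tc (≢-sym c≢ℓ) λ tℓʲ t¬cʲ →
                                                  ∄k (_ , tℓʲ , t¬cʲ)))

  n+1≤slack² : Fin n → 8 ≤ n → n + 1 ≤ slack ^ 2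
  n+1≤slack² i 8≤n = n+1≤K² slack 8≤n (begin
    n                                     ≤⟨ n≤1+∑degree i ⟩
    1 + ∑ₗ (Γ i) degree                   ≤⟨ +-monoʳ-≤ 1 (∑ₗ-mono-≤ (Γ i) (λ _ → degree≤2⊔pred-slack _)) ⟩
    1 + ∑ₗ (Γ i) (λ _ → 2 ⊔ pred slack)   ≡⟨ cong (1 +_) (∑ₗ-const (Γ i) (2 ⊔ pred slack)) ⟩
    1 + length (Γ i) * (2 ⊔ pred slack)   ≤⟨ +-monoʳ-≤ 1 (*-monoˡ-≤ (2 ⊔ pred slack) (Γ-length≤slack i)) ⟩
    1 + slack * (2 ⊔ pred slack)          ∎)
    where open ≤-Reasoning

lemma25 : (n m : ℕ) → 8 ≤ n → (φ : CNF n m) → IsGenPEncoding φ → IsRegular φ →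
    (2 * n ≤ #clauses φ + 2) × (n + 1 ≤ (#clauses φ + 2 ∸ 2 * n) ^ 2)
lemma25 zero    m () φ enc reg
lemma25 (suc n) m 8≤n φ enc reg = ≤-trans 2n≤#clauses (m≤m+n _ 2) , n+1≤slack² zero 8≤n
  where open RegularEncoding φ enc reg
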